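{- Let $p\ge 5$ be a prime, let $\nu$ be an integer with $p\nmid\nu$, and for integers $y_1,y_2,y_7,y_8$ put $S_j=y_1^j+y_2^j-y_7^j-y_8^j$ for $j=1,2,3$. For integers $a\ge 1$ and $c\ge 0$, let $N(p;a,c)$ denote the number of quadruples $(y_1,y_2,y_7,y_8)$ of residues modulo $p^c$ satisfying \[2\nu S_1+p^aS_2\equiv 0 \pmod{p^c}\quad\text{and}\quad 3\nu S_2+2p^aS_3\equiv 0\pmod{p^c}.\] Then $N(p;a,c)\le (c+1)p^{2c}$. -}

module Defs where

open import Data.Nat as ℕ using (ℕ)
open import Data.Integer as ℤ using (ℤ; +_; _+_; _-_; _*_; _^_)
open import Data.Integer.Divisibility.Signed using (_∣_; _∣?_)
open import Data.List using (List; []; _∷_; upTo; length; filter; concatMap)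
open import Data.Product using (_×_; _,_)
open import Relation.Nullary using (Dec)
open import Relation.Nullary.Decidable using (_×-dec_)

Congr : ℤ → ℤ → ℤ → Set
Congr m x y = m ∣ (x - y)

S : ℕ → ℤ → ℤ → ℤ → ℤ → ℤ
S j y1 y2 y7 y8 = y1 ^ j + y2 ^ j - y7 ^ j - y8 ^ j

Quad : Set
Quad = ℤ × ℤ × ℤ × ℤ

quads : ℕ → List Quad
quads M = concatMap (λ a → concatMap (λ b → concatMap (λ c → concatMap (λ d →
  (+ a , + b , + c , + d) ∷ []) (upTo M)) (upTo M)) (upTo M)) (upTo M)

Cond : ℕ → ℤ → ℕ → ℕ → Quad → Set
Cond p ν a c (y1 , y2 , y7 , y8) =
  Congr ((+ p) ^ c) ((+ 2) * ν * S 1 y1 y2 y7 y8 + (+ p) ^ a * S 2 y1 y2 y7 y8) (+ 0)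
  × Congr ((+ p) ^ c) ((+ 3) * ν * S 2 y1 y2 y7 y8 + (+ 2) * (+ p) ^ a * S 3 y1 y2 y7 y8) (+ 0)

cond? : ∀ p ν a c (q : Quad) → Dec (Cond p ν a c q)
cond? p ν a c (y1 , y2 , y7 , y8) = (_ ∣? _) ×-dec (_ ∣? _)

N : ℕ → ℤ → ℕ → ℕ → ℕ
N p ν a c = length (filter (cond? p ν a c) (quads (p ℕ.^ c)))

-- Put M = p^c and, for a quadruple y, δ = (y₁+y₂)-(y₇+y₈), u = (y₁-y₂)-(y₇-y₈),
-- w = (y₁-y₂)+(y₇-y₈).
--  1. Eliminating ν.  Two polynomial identities combine the congruences into
--     M ∣ u·w·T  and  M ∣ δ·U + p^a·u·w,  where U ≡ 4ν and T ≡ 12ν² (mod p).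
--     Since p ≥ 5 and p ∤ ν, both U and T are prime to p; hence M ∣ u·w and M ∣ δ.
--  2. Divisor pairs.  Writing U = p^k·U' with k = min(v_p U, c), any W with M ∣ U·W
--     is a multiple of p^(c-k), so the pair (U,W) ∈ [0,M)² is coded injectively by
--     the digits (W/p^(c-k), U', k) into [0, (c+1)·M).
--  3. Reconstruction.  As 2 is invertible mod M, a quadruple of residues with M ∣ δ
--     is determined by y₇, u mod M and w mod M.
--  4. Counting.  Hence y ↦ (y₇, code(u mod M, w mod M)) is injective on the solutions,
--     with values in [0, M·(c+1)·M); an injective coding bounds the count.
-- The file proves general counting facts for lists, the enumeration of residues,
-- divisibility by prime powers, mixed-radix digits and the divisor-pair code, then
-- the steps 1 and 3 for the quadruples, and finally lemma8.

module Submission where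

open import Defs
open import Data.Nat as ℕ using (ℕ; NonZero)
open import Data.Nat.Primality using (Prime)
open import Data.Integer using (ℤ; +_)
import Data.Integer.Divisibility.Signed as ℤ
open import Relation.Nullary using (¬_)

module Counting where

  open import Data.Nat using (ℕ; suc; _<_; _≤_; z≤n; s≤s; _<?_)
  open import Data.Nat.Properties using (≤-trans; ≤-reflexive; ≤-pred; ≤-antisym; ≤∧≢⇒<; ≮⇒≥)
  open import Data.List using (List; []; _∷_; length; filter; map; concatMap)
  open import Data.List.Properties using (filter-all; length-map)
  open import Data.List.Relation.Unary.All as All using (All; []; _∷_)
  import Data.List.Relation.Unary.All.Properties as AllP
  import Data.List.Relation.Unary.AllPairs as AllPairs
  import Data.List.Relation.Unary.AllPairs.Properties as AllPairsP
  open import Data.List.Relation.Unary.Unique.Propositional using (Unique; []; _∷_)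
  import Data.List.Relation.Unary.Unique.Propositional.Properties as UniqueP
  open import Data.List.Relation.Binary.Disjoint.Propositional using (Disjoint)
  open import Data.Product using (_×_; _,_)
  open import Relation.Nullary using (yes; no)
  open import Relation.Unary using (Decidable)
  open import Relation.Binary.PropositionalEquality using (_≡_; _≢_; sym; trans; cong; subst)

  -- In a duplicate-free list below n+1 at most one entry (namely n) is not below n.
  length≤suc-filter< : ∀ n (<n? : Decidable (_< n)) zs → Unique zs → All (_< suc n) zs →
                       length zs ≤ suc (length (filter <n? zs))
  length≤suc-filter< n <n? [] [] [] = z≤n
  length≤suc-filter< n <n? (z ∷ zs) (z∉zs ∷ zs-unique) (z<1+n ∷ zs<1+n) with <n? z
  ... | yes _ = s≤s (length≤suc-filter< n <n? zs zs-unique zs<1+n)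
  ... | no z≮n = s≤s (≤-reflexive (sym (cong length (filter-all <n? zs<n))))
    where
    z≡n : z ≡ n
    z≡n = ≤-antisym (≤-pred z<1+n) (≮⇒≥ z≮n)
    zs<n : All (_< n) zs
    zs<n = All.zipWith (λ (z≢v , v<1+n) → ≤∧≢⇒< (≤-pred v<1+n) (λ v≡n → z≢v (trans z≡n (sym v≡n))))
                       (z∉zs , zs<1+n)

  unique-below⇒length≤ : ∀ n zs → Unique zs → All (_< n) zs → length zs ≤ n
  unique-below⇒length≤ 0 [] _ _ = z≤n
  unique-below⇒length≤ 0 (_ ∷ _) _ (() ∷ _)
  unique-below⇒length≤ (suc n) zs zs-unique zs< = ≤-trans (length≤suc-filter< n (_<? n) zs zs-unique zs<)
    (s≤s (unique-below⇒length≤ n (filter (_<? n) zs)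
            (UniqueP.filter⁺ (_<? n) zs-unique) (AllP.all-filter (_<? n) zs)))

  map-unique : ∀ {A B : Set} {R : A → Set} (f : A → B) → (∀ {x y} → R x → R y → f x ≡ f y → x ≡ y) →
               ∀ {ys} → Unique ys → All R ys → Unique (map f ys)
  map-unique f f-inj [] [] = []
  map-unique f f-inj (y∉ys ∷ ys-unique) (ry ∷ rys) =
    AllP.map⁺ (All.zipWith (λ (y≢v , rv) fy≡fv → y≢v (f-inj ry rv fy≡fv)) (y∉ys , rys))
    ∷ map-unique f f-inj ys-unique rys

  filter-length≤ : ∀ {A : Set} {Q P : A → Set} (P? : Decidable P) (f : A → ℕ) (n : ℕ) →
                   (∀ {x} → Q x → P x → f x < n) →
                   (∀ {x y} → Q x → Q y → P x → P y → f x ≡ f y → x ≡ y) →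
                   ∀ xs → Unique xs → All Q xs → length (filter P? xs) ≤ n
  filter-length≤ {Q = Q} {P} P? f n f< f-inj xs xs-unique xs-Q =
    subst (_≤ n) (length-map f ys)
      (unique-below⇒length≤ n (map f ys)
        (map-unique f (λ (q₁ , p₁) (q₂ , p₂) → f-inj q₁ q₂ p₁ p₂) (UniqueP.filter⁺ P? xs-unique) ys-QP)
        (AllP.map⁺ (All.map (λ (q , p) → f< q p) ys-QP)))
    where
    ys = filter P? xs
    ys-QP : All (λ x → Q x × P x) ys
    ys-QP = All.zip (AllP.filter⁺ P? xs-Q , AllP.all-filter P? xs)

  concatMap-all : ∀ {A B : Set} {R : A → Set} {P : B → Set} {g : A → List B} {xs} →
                  All R xs → (∀ {x} → R x → All P (g x)) → All P (concatMap g xs)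
  concatMap-all rs g-all = AllP.concat⁺ (AllP.map⁺ (All.map g-all rs))

  concatMap-unique : ∀ {A B : Set} {g : A → List B} (π : B → A) →
                     (∀ x → Unique (g x)) → (∀ x → All (λ v → π v ≡ x) (g x)) →
                     ∀ {xs} → Unique xs → Unique (concatMap g xs)
  concatMap-unique {g = g} π g-unique g-tagged {xs} xs-unique =
    UniqueP.concat⁺ (AllP.map⁺ (All.universal g-unique xs))
                    (AllPairsP.map⁺ (AllPairs.map disjoint xs-unique))
    where
    disjoint : ∀ {x y} → x ≢ y → Disjoint (g x) (g y)
    disjoint x≢y (v∈gx , v∈gy) = x≢y (trans (sym (All.lookup (g-tagged _) v∈gx)) (All.lookup (g-tagged _) v∈gy))

module Enumeration where

  open import Data.Nat using (ℕ; _<_)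
  open import Data.Integer using (ℤ; +_; ∣_∣)
  open import Data.List using ([]; _∷_)
  open import Data.List.Relation.Unary.All using (All; []; _∷_)
  open import Data.List.Relation.Unary.All.Properties using (all-upTo)
  open import Data.List.Relation.Unary.Unique.Propositional using (Unique; []; _∷_)
  open import Data.List.Relation.Unary.Unique.Propositional.Properties using (upTo⁺)
  open import Data.Product using (Σ; _×_; _,_)
  open import Relation.Binary.PropositionalEquality using (_≡_; refl)
  open Counting

  Residue : ℕ → ℤ → Set
  Residue M y = Σ ℕ λ a → y ≡ + a × a < M

  ResidueQuad : ℕ → Quad → Set
  ResidueQuad M (y1 , y2 , y7 , y8) = Residue M y1 × Residue M y2 × Residue M y7 × Residue M y8

  quads-residues : ∀ M → All (ResidueQuad M) (quads M)
  quads-residues M =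
    concatMap-all (all-upTo M) λ {a} a<M → concatMap-all (all-upTo M) λ {b} b<M →
    concatMap-all (all-upTo M) λ {c} c<M → concatMap-all (all-upTo M) λ {d} d<M →
    ((a , refl , a<M) , (b , refl , b<M) , (c , refl , c<M) , (d , refl , d<M)) ∷ []

  -- Each level of the nested enumeration is tagged by the corresponding coordinate.
  quads-unique : ∀ M → Unique (quads M)
  quads-unique M =
    concatMap-unique (λ (y1 , _ , _ , _) → ∣ y1 ∣)
      (λ _ → concatMap-unique (λ (_ , y2 , _ , _) → ∣ y2 ∣)
        (λ _ → concatMap-unique (λ (_ , _ , y7 , _) → ∣ y7 ∣)
          (λ _ → concatMap-unique (λ (_ , _ , _ , y8) → ∣ y8 ∣) (λ _ → [] ∷ []) (λ _ → refl ∷ []) (upTo⁺ M))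
          (λ _ → concatMap-all (all-upTo M) λ _ → refl ∷ []) (upTo⁺ M))
        (λ _ → concatMap-all (all-upTo M) λ _ → concatMap-all (all-upTo M) λ _ → refl ∷ []) (upTo⁺ M))
      (λ _ → concatMap-all (all-upTo M) λ _ → concatMap-all (all-upTo M) λ _ →
             concatMap-all (all-upTo M) λ _ → refl ∷ [])
      (upTo⁺ M)

module PrimePowers where

  open import Data.Nat as ℕ using (zero; suc)
  open import Data.Nat.Properties using (*-comm; *-assoc; <⇒≱)
  open import Data.Nat.Divisibility as ℕ using (divides; ∣-trans; m∣m*n; *-cancelˡ-∣; *-monoʳ-∣; 1∣_; ∣⇒≤)
  open import Data.Nat.Primality using (Prime; euclidsLemma; prime⇒nonZero)
  open import Data.Integer using (+_; ∣_∣; _+_; _*_; _^_)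
  open import Data.Integer.Properties using (abs-*; pos-*)
  open import Data.Integer.Divisibility.Signed using (_∣_; ∣ᵤ⇒∣; ∣⇒∣ᵤ; ∣m+n∣n⇒∣m)
  open import Data.Empty using (⊥-elim)
  open import Data.Sum using (inj₁; inj₂)
  open import Relation.Nullary using (¬_)
  open import Relation.Binary.PropositionalEquality using (_≡_; refl; sym; trans; cong; subst)

  -- Iterated Euclid's lemma: p^j ∣ t·z and p ∤ t give p^j ∣ z.
  prime-power-cancel : ∀ {p t} → Prime p → ¬ (p ℕ.∣ t) → ∀ j z → p ℕ.^ j ℕ.∣ t ℕ.* z → p ℕ.^ j ℕ.∣ z
  prime-power-cancel _ _ zero z _ = 1∣ z
  prime-power-cancel {p} {t} p-prime p∤t (suc j) z pʲ⁺¹∣tz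
    with euclidsLemma t z p-prime (∣-trans (m∣m*n (p ℕ.^ j)) pʲ⁺¹∣tz)
  ... | inj₁ p∣t = ⊥-elim (p∤t p∣t)
  ... | inj₂ (divides q refl) = subst (p ℕ.^ suc j ℕ.∣_) (*-comm p q) (*-monoʳ-∣ p pʲ∣q)
    where
    instance
      p≢0 : NonZero p
      p≢0 = prime⇒nonZero p-prime
    regroup : t ℕ.* (q ℕ.* p) ≡ p ℕ.* (t ℕ.* q)
    regroup = trans (sym (*-assoc t q p)) (*-comm (t ℕ.* q) p)
    pʲ∣q : p ℕ.^ j ℕ.∣ q
    pʲ∣q = prime-power-cancel p-prime p∤t j q (*-cancelˡ-∣ p (subst (p ℕ.^ suc j ℕ.∣_) regroup pʲ⁺¹∣tz))

  prime-power-cancelℤ : ∀ {p t z} → Prime p → ¬ (+ p ∣ t) → ∀ j → + (p ℕ.^ j) ∣ t * z → + (p ℕ.^ j) ∣ z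
  prime-power-cancelℤ {t = t} {z} p-prime p∤t j pʲ∣tz =
    ∣ᵤ⇒∣ (prime-power-cancel p-prime (λ p∣t → p∤t (∣ᵤ⇒∣ p∣t)) j ∣ z ∣ (subst (_ ℕ.∣_) (abs-* t z) (∣⇒∣ᵤ pʲ∣tz)))

  prime-∤-* : ∀ {p a b} → Prime p → ¬ (+ p ∣ a) → ¬ (+ p ∣ b) → ¬ (+ p ∣ a * b)
  prime-∤-* {a = a} {b} p-prime p∤a p∤b p∣ab
    with euclidsLemma ∣ a ∣ ∣ b ∣ p-prime (subst (_ ℕ.∣_) (abs-* a b) (∣⇒∣ᵤ p∣ab))
  ... | inj₁ p∣a = p∤a (∣ᵤ⇒∣ p∣a)
  ... | inj₂ p∣b = p∤b (∣ᵤ⇒∣ p∣b)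

  ∤-+-multiple : ∀ {k a b} → ¬ (k ∣ a) → k ∣ b → ¬ (k ∣ a + b)
  ∤-+-multiple k∤a k∣b k∣a+b = k∤a (∣m+n∣n⇒∣m k∣a+b k∣b)

  ∤-small : ∀ {p k} → suc k ℕ.< p → ¬ (+ p ∣ + suc k)
  ∤-small k<p p∣k = <⇒≱ k<p (∣⇒≤ (∣⇒∣ᵤ p∣k))

  pos-^ : ∀ n c → (+ n) ^ c ≡ + (n ℕ.^ c)
  pos-^ n zero = refl
  pos-^ n (suc c) = trans (cong (+ n *_) (pos-^ n c)) (sym (pos-* n (n ℕ.^ c)))

module MixedRadix where

  open import Data.Nat using (suc; _<_; _+_; _*_; _%_; >-nonZero)
  open import Data.Nat.Properties
    using (*-comm; *-suc; +-monoˡ-<; *-monoʳ-≤; +-cancelˡ-≡; *-cancelˡ-≡; m<n⇒0<n; module ≤-Reasoning)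
  open import Data.Nat.DivMod using (m<n⇒m%n≡m; [m+kn]%n≡m%n)
  open import Data.Product using (_×_; _,_)
  open import Relation.Binary.PropositionalEquality using (_≡_; sym; trans; cong; module ≡-Reasoning)

  digits-< : ∀ {A B w u} → w < A → u < B → w + A * u < A * B
  digits-< {A} {B} {w} {u} w<A u<B = begin-strict
    w + A * u  <⟨ +-monoˡ-< (A * u) w<A ⟩
    A + A * u  ≡⟨ *-suc A u ⟨
    A * suc u  ≤⟨ *-monoʳ-≤ A u<B ⟩
    A * B      ∎
    where open ≤-Reasoning

  digits-unique : ∀ {A a a' b b'} → a < A → a' < A → a + A * b ≡ a' + A * b' → a ≡ a' × b ≡ b'
  digits-unique {A} {a} {a'} {b} {b'} a<A a'<A eq =
    a≡a' , *-cancelˡ-≡ b b' A (+-cancelˡ-≡ a (A * b) (A * b') (trans eq (cong (_+ A * b') (sym a≡a'))))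
    where
    instance
      A≢0 = >-nonZero (m<n⇒0<n a<A)
    low-digit : ∀ x y → x < A → (x + A * y) % A ≡ x
    low-digit x y x<A = trans (cong (λ v → (x + v) % A) (*-comm A y)) (trans ([m+kn]%n≡m%n x y A) (m<n⇒m%n≡m x<A))
    open ≡-Reasoning
    a≡a' : a ≡ a'
    a≡a' = begin
      a                  ≡⟨ low-digit a b a<A ⟨
      (a + A * b) % A    ≡⟨ cong (_% A) eq ⟩
      (a' + A * b') % A  ≡⟨ low-digit a' b' a'<A ⟩
      a'                 ∎

-- Removing at most f factors p from n:  split f n = (k , m)  with  n = p^k·m,  k ≤ f,
-- and either k = f or p ∤ m.  For n ≠ 0 this is k = min(v_p n, f).
module PowerSplitting (p : ℕ) .{{_ : NonZero p}} where

  open import Data.Nat using (ℕ; zero; suc; _≤_; z≤n; s≤s; _*_; _^_; _/_)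
  open import Data.Nat.Properties using (*-assoc; *-identityˡ)
  open import Data.Nat.Divisibility using (_∣_; _∣?_)
  open import Data.Nat.DivMod using (m*[n/m]≡n)
  open import Data.Product using (_×_; _,_; proj₁; proj₂; map₁)
  open import Data.Sum using (_⊎_; inj₁; inj₂)
  open import Relation.Nullary using (¬_; yes; no)
  open import Relation.Binary.PropositionalEquality using (_≡_; refl; sym; cong; module ≡-Reasoning)

  split : ℕ → ℕ → ℕ × ℕ
  split zero n = 0 , n
  split (suc f) n with p ∣? n
  ... | yes _ = map₁ suc (split f (n / p))
  ... | no _ = 0 , n

  split-≤ : ∀ f n → proj₁ (split f n) ≤ f
  split-≤ zero n = z≤n
  split-≤ (suc f) n with p ∣? n
  ... | yes _ = s≤s (split-≤ f (n / p))
  ... | no _ = z≤n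

  split-factors : ∀ f n → n ≡ p ^ proj₁ (split f n) * proj₂ (split f n)
  split-factors zero n = sym (*-identityˡ n)
  split-factors (suc f) n with p ∣? n
  ... | no _ = sym (*-identityˡ n)
  ... | yes p∣n = begin
    n                  ≡⟨ m*[n/m]≡n p∣n ⟨
    p * (n / p)        ≡⟨ cong (p *_) (split-factors f (n / p)) ⟩
    p * (p ^ k * m)    ≡⟨ *-assoc p (p ^ k) m ⟨
    p * p ^ k * m      ∎
    where
    open ≡-Reasoning
    k = proj₁ (split f (n / p))
    m = proj₂ (split f (n / p))

  split-stops : ∀ f n → proj₁ (split f n) ≡ f ⊎ ¬ (p ∣ proj₂ (split f n))
  split-stops zero n = inj₁ refl
  split-stops (suc f) n with p ∣? n
  ... | no p∤n = inj₂ p∤n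
  ... | yes _ with split-stops f (n / p)
  ...   | inj₁ k≡f = inj₁ (cong suc k≡f)
  ...   | inj₂ p∤m = inj₂ p∤m

-- The pairs (U, W) ∈ [0, M)² with M = p^c dividing U·W are coded injectively into
-- [0, (c+1)·M): with U = p^k·U' as in PowerSplitting, p^(c-k) divides W, and the
-- digits of the code are W/p^(c-k) < p^k, U' < p^(c-k) and k ≤ c.
module DivisorPairs (p : ℕ) (p-prime : Prime p) (c : ℕ) where

  open import Data.Nat using (suc; NonZero; _<_; s≤s; _+_; _*_; _^_; _∸_; _/_)
  open import Data.Nat.Properties using (m^n≢0; *-assoc; n∸n≡0; m+[n∸m]≡n; ^-distribˡ-+-*; *-cancelˡ-<; *-cancelʳ-<)
  open import Data.Nat.Divisibility using (_∣_; *-cancelˡ-∣; 1∣_)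
  open import Data.Nat.DivMod using (m/n*n≡m)
  open import Data.Nat.Primality using (prime⇒nonZero)
  open import Data.Product using (_×_; _,_; proj₁; proj₂)
  open import Data.Sum using (inj₁; inj₂)
  open import Relation.Binary.PropositionalEquality
    using (_≡_; sym; trans; cong; cong₂; subst; subst₂; module ≡-Reasoning)
  open PrimePowers using (prime-power-cancel)
  open MixedRadix

  private instance
    p≢0 : NonZero p
    p≢0 = prime⇒nonZero p-prime

  open PowerSplitting p

  M : ℕ
  M = p ^ c

  exponent cofactor gap : ℕ → ℕ
  exponent U = proj₁ (split c U)
  cofactor U = proj₂ (split c U)
  gap U = c ∸ exponent U

  quotient lower code : ℕ → ℕ → ℕ
  quotient U W = (W / p ^ gap U) {{m^n≢0 p (gap U)}}
  lower U W = quotient U W + p ^ exponent U * cofactor U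
  code U W = lower U W + M * exponent U

  M-split : ∀ U → M ≡ p ^ exponent U * p ^ gap U
  M-split U = trans (cong (p ^_) (sym (m+[n∸m]≡n (split-≤ c U)))) (^-distribˡ-+-* p (exponent U) (gap U))

  gap∣W : ∀ U W → M ∣ U * W → p ^ gap U ∣ W
  gap∣W U W M∣UW with split-stops c U
  ... | inj₁ k≡c = subst (λ j → p ^ j ∣ W) (sym (trans (cong (c ∸_) k≡c) (n∸n≡0 c))) (1∣ W)
  ... | inj₂ p∤U' = prime-power-cancel p-prime p∤U' (gap U) W
        (*-cancelˡ-∣ (p ^ exponent U) {{m^n≢0 p (exponent U)}} (subst₂ _∣_ (M-split U) UW≡ M∣UW))
    where
    UW≡ : U * W ≡ p ^ exponent U * (cofactor U * W)
    UW≡ = trans (cong (_* W) (split-factors c U)) (*-assoc (p ^ exponent U) (cofactor U) W)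

  W≡quotient : ∀ U W → M ∣ U * W → W ≡ quotient U W * p ^ gap U
  W≡quotient U W M∣UW = sym (m/n*n≡m {{m^n≢0 p (gap U)}} (gap∣W U W M∣UW))

  cofactor< : ∀ U → U < M → cofactor U < p ^ gap U
  cofactor< U U<M = *-cancelˡ-< (p ^ exponent U) (cofactor U) (p ^ gap U)
    (subst₂ _<_ (split-factors c U) (M-split U) U<M)

  quotient< : ∀ U W → W < M → M ∣ U * W → quotient U W < p ^ exponent U
  quotient< U W W<M M∣UW = *-cancelʳ-< (p ^ gap U) (quotient U W) (p ^ exponent U)
    (subst₂ _<_ (W≡quotient U W M∣UW) (M-split U) W<M)

  lower< : ∀ U W → U < M → W < M → M ∣ U * W → lower U W < M
  lower< U W U<M W<M M∣UW =
    subst (lower U W <_) (sym (M-split U)) (digits-< (quotient< U W W<M M∣UW) (cofactor< U U<M))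

  code< : ∀ U W → U < M → W < M → M ∣ U * W → code U W < M * suc c
  code< U W U<M W<M M∣UW = digits-< (lower< U W U<M W<M M∣UW) (s≤s (split-≤ c U))

  code-injective : ∀ {U W U' W'} → U < M → W < M → U' < M → W' < M → M ∣ U * W → M ∣ U' * W' →
                   code U W ≡ code U' W' → U ≡ U' × W ≡ W'
  code-injective {U} {W} {U'} {W'} U<M W<M U'<M W'<M M∣UW M∣U'W' eq = U≡U' , W≡W'
    where
    open ≡-Reasoning
    high = digits-unique (lower< U W U<M W<M M∣UW) (lower< U' W' U'<M W'<M M∣U'W') eq
    k≡k' : exponent U ≡ exponent U'
    k≡k' = proj₂ high
    low = digits-unique {A = p ^ exponent U} (quotient< U W W<M M∣UW)
            (subst (λ k → quotient U' W' < p ^ k) (sym k≡k') (quotient< U' W' W'<M M∣U'W'))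
            (trans (proj₁ high) (cong (λ k → quotient U' W' + p ^ k * cofactor U') (sym k≡k')))
    U≡U' : U ≡ U'
    U≡U' = begin
      U                             ≡⟨ split-factors c U ⟩
      p ^ exponent U * cofactor U   ≡⟨ cong₂ (λ k m → p ^ k * m) k≡k' (proj₂ low) ⟩
      p ^ exponent U' * cofactor U' ≡⟨ split-factors c U' ⟨
      U'                            ∎
    W≡W' : W ≡ W'
    W≡W' = begin
      W                             ≡⟨ W≡quotient U W M∣UW ⟩
      quotient U W * p ^ gap U      ≡⟨ cong₂ (λ q k → q * p ^ (c ∸ k)) (proj₁ low) k≡k' ⟩
      quotient U' W' * p ^ gap U'   ≡⟨ W≡quotient U' W' M∣U'W' ⟨
      W'                            ∎

module Congruences (M : ℕ) .{{_ : NonZero M}} where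

  open import Data.Nat as ℕ using (_≤_; _<_)
  open import Data.Nat.Properties using (≤-antisym; ≤-total; ≤-<-trans; m∸n≤m; m∸n≡0⇒m≤n)
  open import Data.Nat.Divisibility as ℕ using (n∣m⇒m%n≡0)
  open import Data.Nat.DivMod using (m<n⇒m%n≡m)
  open import Data.Integer using (ℤ; +_; ∣_∣; _+_; _-_; _*_; _⊖_)
  open import Data.Integer.Properties using (m-n≡m⊖n; ∣⊖∣-≤; ∣m⊖n∣≡∣n⊖m∣; abs-*)
  open import Data.Integer.Tactic.RingSolver using (solve-∀)
  open import Data.Integer.DivMod using (_%ℕ_; _/ℕ_; a≡a%ℕn+[a/ℕn]*n)
  open import Data.Integer.Divisibility.Signed using (_∣_; divides; ∣⇒∣ᵤ; ∣m∣n⇒∣m-n; ∣m⇒∣m*n; ∣n⇒∣m*n)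
  open import Data.Sum using (inj₁; inj₂)
  open import Relation.Binary.PropositionalEquality using (_≡_; sym; trans; cong; subst)

  below-multiple≡0 : ∀ {x} → x < M → M ℕ.∣ x → x ≡ 0
  below-multiple≡0 {x} x<M M∣x = trans (sym (m<n⇒m%n≡m x<M)) (n∣m⇒m%n≡0 x M M∣x)

  ordered-residues-equal : ∀ {a b} → a ≤ b → b < M → M ℕ.∣ ∣ a ⊖ b ∣ → a ≡ b
  ordered-residues-equal {a} {b} a≤b b<M M∣a⊖b = ≤-antisym a≤b (m∸n≡0⇒m≤n
    (below-multiple≡0 (≤-<-trans (m∸n≤m b a) b<M) (subst (M ℕ.∣_) (∣⊖∣-≤ a≤b) M∣a⊖b)))

  residues-equal : ∀ {a b} → a < M → b < M → + M ∣ + a - + b → a ≡ b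
  residues-equal {a} {b} a<M b<M M∣a-b with ≤-total a b
  ... | inj₁ a≤b = ordered-residues-equal a≤b b<M M∣a⊖b
    where M∣a⊖b = subst (M ℕ.∣_) (cong ∣_∣ (m-n≡m⊖n a b)) (∣⇒∣ᵤ M∣a-b)
  ... | inj₂ b≤a = sym (ordered-residues-equal b≤a a<M (subst (M ℕ.∣_) (∣m⊖n∣≡∣n⊖m∣ a b) M∣a⊖b))
    where M∣a⊖b = subst (M ℕ.∣_) (cong ∣_∣ (m-n≡m⊖n a b)) (∣⇒∣ᵤ M∣a-b)

  ∣-residue : ∀ i → + M ∣ i - + (i %ℕ M)
  ∣-residue i = divides (i /ℕ M) (trans (cong (_- r) (a≡a%ℕn+[a/ℕn]*n i M)) (cancel r _))
    where
    r = + (i %ℕ M)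
    cancel : ∀ (x y : ℤ) → (x + y) - x ≡ y
    cancel = solve-∀

  residues≡⇒∣ : ∀ i j → i %ℕ M ≡ j %ℕ M → + M ∣ i - j
  residues≡⇒∣ i j eq = subst (+ M ∣_) (difference i j (+ (i %ℕ M)))
    (∣m∣n⇒∣m-n (∣-residue i) (subst (λ r → + M ∣ j - + r) (sym eq) (∣-residue j)))
    where
    difference : ∀ (x y r : ℤ) → (x - r) - (y - r) ≡ x - y
    difference = solve-∀

  residue-* : ∀ i j → + M ∣ i * j → M ℕ.∣ (i %ℕ M) ℕ.* (j %ℕ M)
  residue-* i j M∣ij = subst (M ℕ.∣_) (abs-* r s) (∣⇒∣ᵤ (subst (+ M ∣_) (expand i j r s)
    (∣m∣n⇒∣m-n (∣m∣n⇒∣m-n M∣ij (∣m⇒∣m*n j (∣-residue i))) (∣n⇒∣m*n r (∣-residue j)))))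
    where
    r = + (i %ℕ M)
    s = + (j %ℕ M)
    expand : ∀ (x y a b : ℤ) → x * y - (x - a) * y - a * (y - b) ≡ a * b
    expand = solve-∀

module LinearForms where

  open import Data.Integer using (ℤ; +_; _+_; _-_; _*_)
  open import Data.Integer.Tactic.RingSolver using (solve-∀)
  open import Data.Integer.Solver using (module +-*-Solver)
  open import Data.Product using (_,_)
  open import Relation.Binary.PropositionalEquality using (_≡_; refl)

  δ u w : Quad → ℤ
  δ (y1 , y2 , y7 , y8) = (y1 + y2) - (y7 + y8)
  u (y1 , y2 , y7 , y8) = (y1 - y2) - (y7 - y8)
  w (y1 , y2 , y7 , y8) = (y1 - y2) + (y7 - y8)

  identity-δ : ∀ (ν P y1 y2 y7 y8 : ℤ) →
    (+ 2) * ((+ 2) * ν * S 1 y1 y2 y7 y8 + P * S 2 y1 y2 y7 y8)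
      ≡ ((y1 + y2) - (y7 + y8)) * ((+ 4) * ν + P * ((y1 + y2) + (y7 + y8)))
        + P * (((y1 - y2) - (y7 - y8)) * ((y1 - y2) + (y7 - y8)))
  identity-δ = solve 6 (λ ν P y1 y2 y7 y8 →
      let s = y1 :+ y2 ; t = y7 :+ y8 in
      con (+ 2) :* (con (+ 2) :* ν :* (y1 :^ 1 :+ y2 :^ 1 :- y7 :^ 1 :- y8 :^ 1)
                    :+ P :* (y1 :^ 2 :+ y2 :^ 2 :- y7 :^ 2 :- y8 :^ 2))
      := (s :- t) :* (con (+ 4) :* ν :+ P :* (s :+ t))
         :+ P :* (((y1 :- y2) :- (y7 :- y8)) :* ((y1 :- y2) :+ (y7 :- y8)))) refl
    where open +-*-Solver

  -- A combination of both congruences in which δ cancels, leaving u·w times a cofactor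
  -- congruent to 12ν² modulo P.
  identity-uw : ∀ (ν P y1 y2 y7 y8 : ℤ) →
    let s = y1 + y2 ; t = y7 + y8 ; d = y7 - y8 in
    (+ 2) * ((+ 4) * ν + P * (s + t)) * ((+ 3) * ν * S 2 y1 y2 y7 y8 + (+ 2) * P * S 3 y1 y2 y7 y8)
    - (+ 2) * ((+ 3) * ν * (s + t) + P * (s * s + s * t + t * t + (+ 3) * (d * d)))
            * ((+ 2) * ν * S 1 y1 y2 y7 y8 + P * S 2 y1 y2 y7 y8)
      ≡ (((y1 - y2) - d) * ((y1 - y2) + d))
        * ((+ 12) * ν * ν + P * ((+ 12) * ν * s + P * ((+ 2) * s * s + (+ 2) * s * t - t * t - (+ 3) * (d * d))))
  identity-uw = solve 6 (λ ν P y1 y2 y7 y8 →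
      let s = y1 :+ y2 ; t = y7 :+ y8 ; d = y7 :- y8
          S₁ = y1 :^ 1 :+ y2 :^ 1 :- y7 :^ 1 :- y8 :^ 1
          S₂ = y1 :^ 2 :+ y2 :^ 2 :- y7 :^ 2 :- y8 :^ 2
          S₃ = y1 :^ 3 :+ y2 :^ 3 :- y7 :^ 3 :- y8 :^ 3 in
      con (+ 2) :* (con (+ 4) :* ν :+ P :* (s :+ t)) :* (con (+ 3) :* ν :* S₂ :+ con (+ 2) :* P :* S₃)
      :- con (+ 2) :* (con (+ 3) :* ν :* (s :+ t) :+ P :* (s :* s :+ s :* t :+ t :* t :+ con (+ 3) :* (d :* d)))
                   :* (con (+ 2) :* ν :* S₁ :+ P :* S₂)
      := (((y1 :- y2) :- d) :* ((y1 :- y2) :+ d))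
         :* (con (+ 12) :* ν :* ν :+ P :* (con (+ 12) :* ν :* s
              :+ P :* (con (+ 2) :* s :* s :+ con (+ 2) :* s :* t :- t :* t :- con (+ 3) :* (d :* d))))) refl
    where open +-*-Solver

  -- For quadruples sharing y₇, the forms recover twice the differences of y₁, y₂, y₈.
  twice-Δy₁ : ∀ (y1 y2 y7 y8 z1 z2 z8 : ℤ) →
    (((y1 + y2) - (y7 + y8)) - ((z1 + z2) - (y7 + z8))) + (((y1 - y2) - (y7 - y8)) - ((z1 - z2) - (y7 - z8)))
      ≡ (+ 2) * (y1 - z1)
  twice-Δy₁ = solve-∀

  twice-Δy₂ : ∀ (y1 y2 y7 y8 z1 z2 z8 : ℤ) →
    (((y1 + y2) - (y7 + y8)) - ((z1 + z2) - (y7 + z8))) - (((y1 - y2) + (y7 - y8)) - ((z1 - z2) + (y7 - z8)))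
      ≡ (+ 2) * (y2 - z2)
  twice-Δy₂ = solve-∀

  twice-Δy₈ : ∀ (y1 y2 y7 y8 z1 z2 z8 : ℤ) →
    (((y1 - y2) - (y7 - y8)) - ((z1 - z2) - (y7 - z8))) - (((y1 - y2) + (y7 - y8)) - ((z1 - z2) + (y7 - z8)))
      ≡ (+ 2) * (y8 - z8)
  twice-Δy₈ = solve-∀

module Elimination (p : ℕ) (p-prime : Prime p) (p∤2 : ¬ (+ p ℤ.∣ + 2)) (p∤3 : ¬ (+ p ℤ.∣ + 3))
                   (ν : ℤ) (p∤ν : ¬ (+ p ℤ.∣ ν)) (a′ c : ℕ) where

  open import Data.Nat using (suc)
  open import Data.Integer using (_+_; _-_; _*_; _^_)
  open import Data.Integer.Properties using (+-identityʳ; *-comm)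
  open import Data.Integer.Divisibility.Signed using (_∣_; ∣-refl; ∣m⇒∣m*n; ∣n⇒∣m*n; ∣m∣n⇒∣m-n; ∣m+n∣n⇒∣m)
  open import Data.Product using (_,_)
  open import Relation.Binary.PropositionalEquality using (trans; subst; subst₂)
  open PrimePowers
  open LinearForms

  P : ℤ
  P = (+ p) ^ suc a′

  M : ℤ
  M = + (p ℕ.^ c)

  p∣P : + p ∣ P
  p∣P = ∣m⇒∣m*n ((+ p) ^ a′) ∣-refl

  first-congruence : ∀ y1 y2 y7 y8 → Cond p ν (suc a′) c (y1 , y2 , y7 , y8) →
                     M ∣ (+ 2) * ν * S 1 y1 y2 y7 y8 + P * S 2 y1 y2 y7 y8
  first-congruence _ _ _ _ (h , _) = subst₂ _∣_ (pos-^ p c) (+-identityʳ _) h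

  second-congruence : ∀ y1 y2 y7 y8 → Cond p ν (suc a′) c (y1 , y2 , y7 , y8) →
                      M ∣ (+ 3) * ν * S 2 y1 y2 y7 y8 + (+ 2) * P * S 3 y1 y2 y7 y8
  second-congruence _ _ _ _ (_ , h) = subst₂ _∣_ (pos-^ p c) (+-identityʳ _) h

  p∤4ν+Px : ∀ x → ¬ (+ p ∣ (+ 4) * ν + P * x)
  p∤4ν+Px x = ∤-+-multiple (prime-∤-* p-prime (prime-∤-* p-prime p∤2 p∤2) p∤ν) (∣m⇒∣m*n x p∣P)

  p∤12ν²+Px : ∀ x → ¬ (+ p ∣ (+ 12) * ν * ν + P * x)
  p∤12ν²+Px x = ∤-+-multiple
    (prime-∤-* p-prime (prime-∤-* p-prime (prime-∤-* p-prime (prime-∤-* p-prime p∤2 p∤2) p∤3) p∤ν) p∤ν)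
    (∣m⇒∣m*n x p∣P)

  uw-divisible : ∀ q → Cond p ν (suc a′) c q → M ∣ u q * w q
  uw-divisible q@(y1 , y2 , y7 , y8) h = prime-power-cancelℤ p-prime (p∤12ν²+Px T′) c
    (subst (M ∣_) (trans (identity-uw ν P y1 y2 y7 y8) (*-comm (u q * w q) T))
      (∣m∣n⇒∣m-n (∣n⇒∣m*n ((+ 2) * U) (second-congruence y1 y2 y7 y8 h))
                 (∣n⇒∣m*n ((+ 2) * W) (first-congruence y1 y2 y7 y8 h))))
    where
    s = y1 + y2 ; t = y7 + y8 ; d = y7 - y8
    U = (+ 4) * ν + P * (s + t)
    W = (+ 3) * ν * (s + t) + P * (s * s + s * t + t * t + (+ 3) * (d * d))
    T′ = (+ 12) * ν * s + P * ((+ 2) * s * s + (+ 2) * s * t - t * t - (+ 3) * (d * d))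
    T = (+ 12) * ν * ν + P * T′

  δ-divisible : ∀ q → Cond p ν (suc a′) c q → M ∣ δ q
  δ-divisible q@(y1 , y2 , y7 , y8) h = prime-power-cancelℤ p-prime (p∤4ν+Px ((y1 + y2) + (y7 + y8))) c
    (subst (M ∣_) (*-comm (δ q) U)
      (∣m+n∣n⇒∣m (subst (M ∣_) (identity-δ ν P y1 y2 y7 y8) (∣n⇒∣m*n (+ 2) (first-congruence y1 y2 y7 y8 h)))
                  (∣n⇒∣m*n P (uw-divisible q h))))
    where
    U = (+ 4) * ν + P * ((y1 + y2) + (y7 + y8))

module Reconstruction (p : ℕ) (p-prime : Prime p) (p∤2 : ¬ (+ p ℤ.∣ + 2)) (c : ℕ) where

  open import Data.Nat using (_<_; _^_)
  open import Data.Nat.Properties using (m^n≢0)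
  open import Data.Nat.Primality using (prime⇒nonZero)
  open import Data.Integer using (_-_; _*_)
  open import Data.Integer.Divisibility.Signed using (_∣_; ∣m∣n⇒∣m+n; ∣m∣n⇒∣m-n)
  open import Data.Product using (_,_)
  open import Relation.Binary.PropositionalEquality using (_≡_; refl; subst)
  open PrimePowers using (prime-power-cancelℤ)
  open LinearForms

  M : ℕ
  M = p ^ c

  instance
    M≢0 : NonZero M
    M≢0 = m^n≢0 p c {{prime⇒nonZero p-prime}}

  open Congruences M using (residues-equal)

  halve : ∀ {x} → + M ∣ (+ 2) * x → + M ∣ x
  halve = prime-power-cancelℤ p-prime p∤2 c

  quad-determined : ∀ {a1 a2 a7 a8 b1 b2 b8} → a1 < M → a2 < M → a8 < M → b1 < M → b2 < M → b8 < M →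
    + M ∣ δ (+ a1 , + a2 , + a7 , + a8) → + M ∣ δ (+ b1 , + b2 , + a7 , + b8) →
    + M ∣ u (+ a1 , + a2 , + a7 , + a8) - u (+ b1 , + b2 , + a7 , + b8) →
    + M ∣ w (+ a1 , + a2 , + a7 , + a8) - w (+ b1 , + b2 , + a7 , + b8) →
    _≡_ {A = Quad} (+ a1 , + a2 , + a7 , + a8) (+ b1 , + b2 , + a7 , + b8)
  quad-determined {a1} {a2} {a7} {a8} {b1} {b2} {b8} a1<M a2<M a8<M b1<M b2<M b8<M M∣δa M∣δb M∣Δu M∣Δw =
    coordinates-equal
      (residues-equal a1<M b1<M (halve (subst (+ M ∣_) (twice-Δy₁ ya1 ya2 ya7 ya8 yb1 yb2 yb8) (∣m∣n⇒∣m+n M∣Δδ M∣Δu))))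
      (residues-equal a2<M b2<M (halve (subst (+ M ∣_) (twice-Δy₂ ya1 ya2 ya7 ya8 yb1 yb2 yb8) (∣m∣n⇒∣m-n M∣Δδ M∣Δw))))
      (residues-equal a8<M b8<M (halve (subst (+ M ∣_) (twice-Δy₈ ya1 ya2 ya7 ya8 yb1 yb2 yb8) (∣m∣n⇒∣m-n M∣Δu M∣Δw))))
    where
    ya1 = + a1 ; ya2 = + a2 ; ya7 = + a7 ; ya8 = + a8 ; yb1 = + b1 ; yb2 = + b2 ; yb8 = + b8
    M∣Δδ = ∣m∣n⇒∣m-n M∣δa M∣δb
    coordinates-equal : a1 ≡ b1 → a2 ≡ b2 → a8 ≡ b8 → _≡_ {A = Quad} (+ a1 , + a2 , + a7 , + a8) (+ b1 , + b2 , + a7 , + b8)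
    coordinates-equal refl refl refl = refl

module Solutions (p : ℕ) (p-prime : Prime p) (5≤p : 5 ℕ.≤ p) (ν : ℤ) (p∤ν : ¬ (+ p ℤ.∣ ν)) (a′ c : ℕ) where

  open import Data.Nat using (suc; _≤_; _<_; z≤n; s≤s; _+_; _*_)
  open import Data.Nat.Properties using (≤-trans)
  import Data.Nat.Divisibility as ℕ
  open import Data.Integer using (∣_∣)
  open import Data.Integer.DivMod using (_%ℕ_; n%ℕd<d)
  open import Data.Product using (_,_; proj₁; proj₂)
  open import Relation.Binary.PropositionalEquality using (_≡_; refl)
  open PrimePowers using (∤-small)
  open Counting using (filter-length≤)
  open Enumeration
  open MixedRadix
  open LinearForms

  p∤2 : ¬ (+ p ℤ.∣ + 2)
  p∤2 = ∤-small (≤-trans (s≤s (s≤s (s≤s z≤n))) 5≤p)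

  p∤3 : ¬ (+ p ℤ.∣ + 3)
  p∤3 = ∤-small (≤-trans (s≤s (s≤s (s≤s (s≤s z≤n)))) 5≤p)

  open Elimination p p-prime p∤2 p∤3 ν p∤ν a′ c using (uw-divisible; δ-divisible)
  open Reconstruction p p-prime p∤2 c using (M; M≢0; quad-determined)
  open DivisorPairs p p-prime c using (code; code<; code-injective)
  open Congruences M using (residues≡⇒∣; residue-*)

  Solution : Quad → Set
  Solution = Cond p ν (suc a′) c

  pair-code : Quad → ℕ
  pair-code q = code (u q %ℕ M) (w q %ℕ M)

  key : Quad → ℕ
  key q@(_ , _ , y7 , _) = ∣ y7 ∣ + M * pair-code q

  pair-divides : ∀ q → Solution q → M ℕ.∣ (u q %ℕ M) * (w q %ℕ M)
  pair-divides q sol = residue-* (u q) (w q) (uw-divisible q sol)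

  pair-code< : ∀ q → Solution q → pair-code q < M * suc c
  pair-code< q sol = code< _ _ (n%ℕd<d (u q) M) (n%ℕd<d (w q) M) (pair-divides q sol)

  key< : ∀ {q} → ResidueQuad M q → Solution q → key q < M * (M * suc c)
  key< {q} (_ , _ , (_ , refl , y7<M) , _) sol = digits-< y7<M (pair-code< q sol)

  key-injective : ∀ {x y} → ResidueQuad M x → ResidueQuad M y → Solution x → Solution y → key x ≡ key y → x ≡ y
  key-injective {x} {y} ((_ , refl , a1<M) , (_ , refl , a2<M) , (_ , refl , a7<M) , (_ , refl , a8<M))
                        ((_ , refl , b1<M) , (_ , refl , b2<M) , (_ , refl , b7<M) , (_ , refl , b8<M)) sol-x sol-y eq
    with digits-unique a7<M b7<M eq
  ... | refl , codes≡ = quad-determined a1<M a2<M a8<M b1<M b2<M b8<M (δ-divisible x sol-x) (δ-divisible y sol-y)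
                          (residues≡⇒∣ (u x) (u y) (proj₁ pairs≡)) (residues≡⇒∣ (w x) (w y) (proj₂ pairs≡))
    where
    pairs≡ = code-injective (n%ℕd<d (u x) M) (n%ℕd<d (w x) M) (n%ℕd<d (u y) M) (n%ℕd<d (w y) M)
               (pair-divides x sol-x) (pair-divides y sol-y) codes≡

  solutions≤ : N p ν (suc a′) c ≤ M * (M * suc c)
  solutions≤ = filter-length≤ (cond? p ν (suc a′) c) key (M * (M * suc c)) (λ {q} → key< {q}) key-injective
                 (quads M) (quads-unique M) (quads-residues M)

open import Data.Nat using (suc; _≤_; _*_; _+_; _^_)
open import Data.Nat.Properties using (^-distribˡ-+-*; +-identityʳ; module ≤-Reasoning)
open import Data.Nat.Tactic.RingSolver using (solve-∀)
open import Data.Integer.Divisibility.Signed using (_∣_)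
open import Relation.Binary.PropositionalEquality using (_≡_; sym; trans; cong)

coding-range : ∀ p c → p ^ c * (p ^ c * suc c) ≡ (c + 1) * p ^ (2 * c)
coding-range p c = trans (regroup (p ^ c) c) (cong ((c + 1) *_) (sym square))
  where
  regroup : ∀ m c → m * (m * suc c) ≡ (c + 1) * (m * m)
  regroup = solve-∀
  square : p ^ (2 * c) ≡ p ^ c * p ^ c
  square = trans (^-distribˡ-+-* p c (c + 0)) (cong (λ k → p ^ c * p ^ k) (+-identityʳ c))

lemma8 : (p : ℕ) → Prime p → 5 ≤ p → (ν : ℤ) → ¬ (+ p ∣ ν) → (a c : ℕ) → 1 ≤ a → N p ν a c ≤ (c + 1) * p ^ (2 * c)
lemma8 p p-prime 5≤p ν p∤ν 0 c ()
lemma8 p p-prime 5≤p ν p∤ν (suc a′) c _ = begin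
  N p ν (suc a′) c            ≤⟨ Solutions.solutions≤ p p-prime 5≤p ν p∤ν a′ c ⟩
  p ^ c * (p ^ c * suc c)     ≡⟨ coding-range p c ⟩
  (c + 1) * p ^ (2 * c)       ∎
  where open ≤-Reasoning
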